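{- Let $q\ge2$, $m\ge1$, and let $F:\{0,\dots,q-1\}^m\to\mathbb{Z}$ with $F(0,\dots,0)=0$ satisfy $\sum_{j=1}^{m-1}F(nq^j)=0$ for all $n\in\mathbb{N}$, and let $b(n)=\sum_{j\in\mathbb{Z}}F(\varepsilon_{j+m-1}(n),\dots,\varepsilon_j(n))$. Let $m'>1$ be an integer. Then the following are equivalent: (i) there exists $n\in\mathbb{N}$ with $m'\nmid b(n)$; (ii) there exists $n<q^m$ with $m'\nmid F(n)$; (iii) there exists $n<q^m$ with $m'\nmid b(n)$.
   Context: $\varepsilon_j(n)$ is the $j$-th base-$q$ digit of the nonnegative integer $n$, with $\varepsilon_j(n)=0$ for $j<0$; for an integer $n\ge0$, $F(n):=F(\varepsilon_{m-1}(n),\dots,\varepsilon_0(n))$. -}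

module Defs where

open import Data.Nat using (ℕ; zero; suc; _∸_; _^_; NonZero; >-nonZero⁻¹)
open import Data.Nat.DivMod using (_/_; _%_; m%n<n)
open import Data.Nat.Properties using (m^n≢0)
open import Data.Integer using (ℤ; +_; -[1+_]; _+_; _-_)
open import Data.Fin using (Fin; fromℕ<; toℕ)
open import Data.Vec using (Vec; tabulate; replicate)

digitQuot : (q : ℕ) → .{{NonZero q}} → ℕ → ℕ → ℕ
digitQuot q j n = (n / (q ^ j)) {{m^n≢0 q j}}

-- ε_j(n) for j : ℤ, with ε_j(n) = 0 for j < 0, as an element of {0,…,q-1}
digitℤ : (q : ℕ) → .{{NonZero q}} → ℤ → ℕ → Fin q
digitℤ q (+ j)     n = fromℕ< (m%n<n (digitQuot q j n) q)
digitℤ q -[1+ j ]  n = fromℕ< (>-nonZero⁻¹ q)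

zeroDigit : (q : ℕ) → .{{NonZero q}} → Fin q
zeroDigit q = fromℕ< (>-nonZero⁻¹ q)

-- the window (ε_{j+m-1}(n), …, ε_j(n)) : position i (0-based) holds ε_{j+m-1-i}(n)
window : (q : ℕ) → .{{NonZero q}} → (m : ℕ) → ℤ → ℕ → Vec (Fin q) m
window q m j n = tabulate (λ (i : Fin m) → digitℤ q (j + + (m ∸ 1 ∸ toℕ i)) n)

-- F(n) := F(ε_{m-1}(n), …, ε_0(n)) for n : ℕ
Fℕ : (q : ℕ) → .{{NonZero q}} → (m : ℕ) → (Vec (Fin q) m → ℤ) → ℕ → ℤ
Fℕ q m F n = F (window q m (+ 0) n)

sumℤ : (ℕ → ℤ) → ℕ → ℤ
sumℤ f zero    = + 0
sumℤ f (suc k) = sumℤ f k + f k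

-- b(n) = Σ_{j ∈ ℤ} F(ε_{j+m-1}(n), …, ε_j(n)).
-- All terms with j < -(m-1) or j > n vanish (window is all zeros, since n < q^n,
-- and F(0,…,0) = 0 is assumed), so the sum is taken over j = -(m-1), …, n,
-- i.e. j = k - (m-1) for k = 0, …, n + m - 1.
b : (q : ℕ) → .{{NonZero q}} → (m : ℕ) → (Vec (Fin q) m → ℤ) → ℕ → ℤ
b q m F n = sumℤ (λ k → F (window q m (+ k - + (m ∸ 1)) n)) (n Data.Nat.+ m)

-- Write m = M + 1 and F(x) for F applied to the last m base-q digits of x.
-- The proof rests on three facts about base-q digits:
--   * b(n) = Σ_{1≤i≤M} F(n·q^i) + Σ_{0≤j≤n} F(⌊n/q^j⌋): the windows at negative
--     positions see n shifted up by q^i, those at position j ≥ 0 see ⌊n/q^j⌋;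
--     under the hypothesis the first sum vanishes, so b is the "digit sum" of F;
--   * F(x) = F(x mod q^m), since F only reads the last m digits;
--   * ⌊k/q^j⌋ < k for j ≥ 1 and k > 0, because q ≥ 2.
-- Hence if d divides F on [0, q^m) it divides every b(n) (periodicity), and if
-- d divides b on [0, q^m) it divides F there (strong induction on k, peeling
-- off the term F(k) of the digit sum of k).  The three conditions of the lemma
-- are the contrapositives, made constructive by bounded search for a witness.

module Submission where

open import Defs
open import Data.Nat using (ℕ; zero; suc; _+_; _*_; _^_; _∸_; _≤_; _<_; NonZero; z≤n; s≤s)
open import Data.Nat.Properties
open import Data.Nat.DivMod
import Data.Nat.Divisibility as ℕ
open import Data.Nat.Induction using (<-rec)
open import Data.Integer as ℤ using (ℤ; +_; _⊖_) renaming (_+_ to _+ℤ_; _-_ to _-ℤ_)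
import Data.Integer.Properties as ℤ
open import Data.Integer.Divisibility using (_∣_)
import Data.Integer.Divisibility.Signed as Signed
open import Data.Integer.Tactic.RingSolver using (solve-∀)
open import Data.Fin using (Fin; toℕ)
open import Data.Fin.Properties using (fromℕ<-cong)
open import Data.Vec using (Vec; replicate)
open import Data.Vec.Properties using (tabulate-cong)
open import Data.Product using (∃-syntax; _×_; _,_)
open import Data.Empty using (⊥-elim)
open import Relation.Nullary using (Dec; yes; no; ¬_; ¬?)
open import Relation.Nullary.Decidable using (decidable-stable)
open import Relation.Binary.PropositionalEquality
open import Function.Base using (_∘_)
open import Function.Bundles using (_⇔_; mk⇔)
open ≡-Reasoning

sum-cong : ∀ {f g : ℕ → ℤ} N → (∀ k → k < N → f k ≡ g k) → sumℤ f N ≡ sumℤ g N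
sum-cong zero    f≡g = refl
sum-cong (suc N) f≡g =
  cong₂ _+ℤ_ (sum-cong N (λ k k<N → f≡g k (m<n⇒m<1+n k<N))) (f≡g N ≤-refl)

sum-split : ∀ (f : ℕ → ℤ) a c → sumℤ f (a + c) ≡ sumℤ f a +ℤ sumℤ (λ k → f (a + k)) c
sum-split f a zero    = trans (cong (sumℤ f) (+-identityʳ a)) (sym (ℤ.+-identityʳ _))
sum-split f a (suc c) = begin
  sumℤ f (a + suc c)                                 ≡⟨ cong (sumℤ f) (+-suc a c) ⟩
  sumℤ f (a + c) +ℤ f (a + c)                        ≡⟨ cong (_+ℤ f (a + c)) (sum-split f a c) ⟩
  sumℤ f a +ℤ sumℤ (λ k → f (a + k)) c +ℤ f (a + c)  ≡⟨ ℤ.+-assoc (sumℤ f a) _ _ ⟩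
  sumℤ f a +ℤ sumℤ (λ k → f (a + k)) (suc c)         ∎

sum-uncons : ∀ (f : ℕ → ℤ) N → sumℤ f (suc N) ≡ f 0 +ℤ sumℤ (λ k → f (suc k)) N
sum-uncons f N =
  trans (sum-split f 1 N) (cong (_+ℤ sumℤ (λ k → f (suc k)) N) (ℤ.+-identityˡ (f 0)))

sum-reverse : ∀ (f : ℕ → ℤ) N → sumℤ f N ≡ sumℤ (λ k → f (N ∸ suc k)) N
sum-reverse f zero    = refl
sum-reverse f (suc N) = begin
  sumℤ f N +ℤ f N                      ≡⟨ ℤ.+-comm (sumℤ f N) (f N) ⟩
  f N +ℤ sumℤ f N                      ≡⟨ cong (f N +ℤ_) (sum-reverse f N) ⟩
  f N +ℤ sumℤ (λ k → f (N ∸ suc k)) N  ≡⟨ sum-uncons (λ k → f (N ∸ k)) N ⟨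
  sumℤ (λ k → f (N ∸ k)) (suc N)       ∎

module _ (d : ℤ) where

  ∣-+ : ∀ x y → d ∣ x → d ∣ y → d ∣ x +ℤ y
  ∣-+ x y d∣x d∣y =
    Signed.∣⇒∣ᵤ (Signed.∣m∣n⇒∣m+n (Signed.∣ᵤ⇒∣ {d} {x} d∣x) (Signed.∣ᵤ⇒∣ {d} {y} d∣y))

  ∣-cancelʳ : ∀ x y → d ∣ x +ℤ y → d ∣ y → d ∣ x
  ∣-cancelʳ x y d∣x+y d∣y = Signed.∣⇒∣ᵤ
    (Signed.∣m+n∣n⇒∣m {d} {x} {y} (Signed.∣ᵤ⇒∣ {d} {x +ℤ y} d∣x+y) (Signed.∣ᵤ⇒∣ {d} {y} d∣y))

  sum-∣ : ∀ (f : ℕ → ℤ) N → (∀ k → k < N → d ∣ f k) → d ∣ sumℤ f N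
  sum-∣ f zero    _   = ℕ._∣0 ℤ.∣ d ∣
  sum-∣ f (suc N) d∣f =
    ∣-+ (sumℤ f N) (f N) (sum-∣ f N (λ k k<N → d∣f k (m<n⇒m<1+n k<N))) (d∣f N ≤-refl)

counterexample : ∀ {P : ℕ → Set} → (∀ n → Dec (P n)) → ∀ N →
                 ¬ (∀ k → k < N → P k) → ∃[ k ] (k < N × ¬ P k)
counterexample P? N ¬all with anyUpTo? (λ k → ¬? (P? k)) N
... | yes found = found
... | no  none  = ⊥-elim (¬all λ k k<N → decidable-stable (P? k) λ ¬Pk → none (k , k<N , ¬Pk))

module _ (q : ℕ) .{{_ : NonZero q}} where

  digit-≡ : ∀ c c′ x y → digitQuot q c x % q ≡ digitQuot q c′ y % q →
            digitℤ q (+ c) x ≡ digitℤ q (+ c′) y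
  digit-≡ c c′ x y e = fromℕ<-cong _ _ e _ _

  quot-quot : ∀ k c n → digitQuot q c (digitQuot q k n) ≡ digitQuot q (k + c) n
  quot-quot k c n = begin
    n / q ^ k / q ^ c    ≡⟨ m/n/o≡m/[n*o] n (q ^ k) (q ^ c) ⟩
    n / (q ^ k * q ^ c)  ≡⟨ /-congʳ (^-distribˡ-+-* q k c) ⟨
    n / q ^ (k + c)      ∎
    where instance
            _ = m^n≢0 q k
            _ = m^n≢0 q c
            q^[k+c]≢0 = m^n≢0 q (k + c)
            nz : NonZero (q ^ k * q ^ c)
            nz = subst NonZero (^-distribˡ-+-* q k c) q^[k+c]≢0

  digit-quot : ∀ k c n → digitℤ q (+ c) (digitQuot q k n) ≡ digitℤ q (+ (k + c)) n
  digit-quot k c n = digit-≡ c (k + c) (digitQuot q k n) n (cong (_% q) (quot-quot k c n))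

  quot-cancel : ∀ c s n → digitQuot q (suc c) (n * q ^ suc s) ≡ digitQuot q c (n * q ^ s)
  quot-cancel c s n = begin
    n * (q * q ^ s) / (q * q ^ c)  ≡⟨ /-congˡ {o = q * q ^ c} (*-comm n (q * q ^ s)) ⟩
    q * q ^ s * n / (q * q ^ c)    ≡⟨ /-congˡ {o = q * q ^ c} (*-assoc q (q ^ s) n) ⟩
    q * (q ^ s * n) / (q * q ^ c)  ≡⟨ m*n/m*o≡n/o q (q ^ s * n) (q ^ c) ⟩
    q ^ s * n / q ^ c              ≡⟨ /-congˡ {o = q ^ c} (*-comm (q ^ s) n) ⟩
    n * q ^ s / q ^ c              ∎
    where instance
            _ = m^n≢0 q c
            _ = m^n≢0 q (suc c)

  last-digit-multiple : ∀ s n → digitQuot q 0 (n * q ^ suc s) % q ≡ 0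
  last-digit-multiple s n = begin
    n * (q * q ^ s) / 1 % q  ≡⟨ %-congˡ (n/1≡n (n * (q * q ^ s))) ⟩
    n * (q * q ^ s) % q      ≡⟨ %-congˡ (cong (n *_) (*-comm q (q ^ s))) ⟩
    n * (q ^ s * q) % q      ≡⟨ %-congˡ (*-assoc n (q ^ s) q) ⟨
    n * q ^ s * q % q        ≡⟨ m*n%n≡0 (n * q ^ s) q ⟩
    0                        ∎

  digit-scale : ∀ c s n → digitℤ q (+ c) (n * q ^ s) ≡ digitℤ q (c ⊖ s) n
  digit-scale c       zero    n =
    digit-≡ c c (n * 1) n (cong (λ x → digitQuot q c x % q) (*-identityʳ n))
  digit-scale zero    (suc s) n = fromℕ<-cong _ _ (last-digit-multiple s n) _ _
  digit-scale (suc c) (suc s) n = begin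
    digitℤ q (+ suc c) (n * q ^ suc s)  ≡⟨ digit-≡ (suc c) c _ _ (cong (_% q) (quot-cancel c s n)) ⟩
    digitℤ q (+ c) (n * q ^ s)          ≡⟨ digit-scale c s n ⟩
    digitℤ q (c ⊖ s) n                  ≡⟨ cong (λ j → digitℤ q j n) (ℤ.[1+m]⊖[1+n]≡m⊖n c s) ⟨
    digitℤ q (suc c ⊖ suc s) n          ∎

  digit-mod : ∀ m c x → c < m → digitℤ q (+ c) ((x % q ^ m) {{m^n≢0 q m}}) ≡ digitℤ q (+ c) x
  digit-mod m c x c<m = digit-≡ c c _ x (begin
    x % q ^ m / q ^ c % q            ≡⟨ %-congˡ {o = q} (/-congˡ {o = q ^ c} (%-congʳ q^m≡)) ⟩
    x % (q ^ e * q ^ c) / q ^ c % q  ≡⟨ %-congˡ (m%[n*o]/o≡m/o%n x (q ^ e) (q ^ c)) ⟩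
    x / q ^ c % q ^ e % q            ≡⟨ m∣n⇒o%n%m≡o%m q (q ^ e) (x / q ^ c) q∣q^e ⟩
    x / q ^ c % q                    ∎)
    where
    e = m ∸ c
    q^m≡ : q ^ m ≡ q ^ e * q ^ c
    q^m≡ = trans (cong (q ^_) (sym (m∸n+n≡m (<⇒≤ c<m)))) (^-distribˡ-+-* q e c)
    q∣q^e : q ℕ.∣ q ^ e
    q∣q^e = subst (λ e′ → q ℕ.∣ q ^ e′) (sym (+-∸-assoc 1 c<m)) (ℕ.m∣m*n (q ^ (m ∸ suc c)))
    instance
      _ = m^n≢0 q c
      _ = m^n≢0 q e
      q^m≢0 = m^n≢0 q m
      nz : NonZero (q ^ e * q ^ c)
      nz = subst NonZero q^m≡ q^m≢0

  shift-down-ℤ : ∀ (M k c : ℤ) → M +ℤ k -ℤ M +ℤ c ≡ k +ℤ c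
  shift-down-ℤ = solve-∀

  shift-up-ℤ : ∀ (k s c : ℤ) → k -ℤ (k +ℤ s) +ℤ c ≡ c -ℤ s
  shift-up-ℤ = solve-∀

  window-cong : ∀ m j i n n′ →
                (∀ c → c < m → digitℤ q (j +ℤ + c) n ≡ digitℤ q (i +ℤ + c) n′) →
                window q m j n ≡ window q m i n′
  window-cong zero    _ _ _ _ _     = refl
  window-cong (suc M) _ _ _ _ agree =
    tabulate-cong λ k → agree (M ∸ toℕ k) (s≤s (m∸n≤m M (toℕ k)))

  window-quot : ∀ m M k n → window q m (+ (M + k) -ℤ + M) n ≡ window q m (+ 0) (digitQuot q k n)
  window-quot m M k n = window-cong m (+ (M + k) -ℤ + M) (+ 0) n _ λ c _ → begin
    digitℤ q (+ (M + k) -ℤ + M +ℤ + c) n  ≡⟨ cong (λ j → digitℤ q j n) (shift-down-ℤ (+ M) (+ k) (+ c)) ⟩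
    digitℤ q (+ (k + c)) n                ≡⟨ digit-quot k c n ⟨
    digitℤ q (+ c) (digitQuot q k n)      ∎

  window-scale : ∀ m k s n → window q m (+ k -ℤ + (k + s)) n ≡ window q m (+ 0) (n * q ^ s)
  window-scale m k s n = window-cong m (+ k -ℤ + (k + s)) (+ 0) n _ λ c _ → begin
    digitℤ q (+ k -ℤ + (k + s) +ℤ + c) n  ≡⟨ cong (λ j → digitℤ q j n) (shift-up-ℤ (+ k) (+ s) (+ c)) ⟩
    digitℤ q (+ c -ℤ + s) n               ≡⟨ cong (λ j → digitℤ q j n) (ℤ.[+m]-[+n]≡m⊖n c s) ⟩
    digitℤ q (c ⊖ s) n                    ≡⟨ digit-scale c s n ⟨
    digitℤ q (+ c) (n * q ^ s)            ∎

  -- F(x) only reads the last m digits of x, so it is q^m-periodic.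
  Fℕ-periodic : ∀ m F x → Fℕ q m F x ≡ Fℕ q m F ((x % q ^ m) {{m^n≢0 q m}})
  Fℕ-periodic m F x = cong F (window-cong m (+ 0) (+ 0) x _ λ c c<m → sym (digit-mod m c x c<m))

  digitSum : (ℕ → ℤ) → ℕ → ℤ
  digitSum G n = sumℤ (λ j → G (digitQuot q j n)) (suc n)

  digitSum-uncons : ∀ (G : ℕ → ℤ) k →
                    digitSum G k ≡ G k +ℤ sumℤ (λ j → G (digitQuot q (suc j) k)) k
  digitSum-uncons G k = trans (sum-uncons _ k) (cong (λ x → G x +ℤ rest) (n/1≡n k))
    where rest = sumℤ (λ j → G (digitQuot q (suc j) k)) k

  -- b(n) = Σ_{1≤i≤M} F(n·q^i) + Σ_{0≤j≤n} F(⌊n/q^j⌋): split the window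
  -- positions j - M (j < n + M + 1) into negative and nonnegative ones.
  b-decomposition : ∀ M F n → b q (suc M) F n ≡
    sumℤ (λ i → Fℕ q (suc M) F (n * q ^ suc i)) M +ℤ digitSum (Fℕ q (suc M) F) n
  b-decomposition M F n = begin
    sumℤ g (n + suc M)
      ≡⟨ cong (sumℤ g) (trans (+-comm n (suc M)) (sym (+-suc M n))) ⟩
    sumℤ g (M + suc n)
      ≡⟨ sum-split g M (suc n) ⟩
    sumℤ g M +ℤ sumℤ (λ k → g (M + k)) (suc n)
      ≡⟨ cong₂ _+ℤ_ negative nonnegative ⟩
    sumℤ (λ i → Fn (n * q ^ suc i)) M +ℤ digitSum Fn n ∎
    where
    Fn : ℕ → ℤ
    Fn = Fℕ q (suc M) F
    g : ℕ → ℤ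
    g k = F (window q (suc M) (+ k -ℤ + M) n)
    g-negative : ∀ k → k < M → g k ≡ Fn (n * q ^ suc (M ∸ suc k))
    g-negative k k<M = cong F (begin
      window q (suc M) (+ k -ℤ + M) n
        ≡⟨ cong (λ M′ → window q (suc M) (+ k -ℤ + M′) n) (m+[n∸m]≡n (<⇒≤ k<M)) ⟨
      window q (suc M) (+ k -ℤ + (k + (M ∸ k))) n
        ≡⟨ window-scale (suc M) k (M ∸ k) n ⟩
      window q (suc M) (+ 0) (n * q ^ (M ∸ k))
        ≡⟨ cong (λ e → window q (suc M) (+ 0) (n * q ^ e)) (+-∸-assoc 1 k<M) ⟩
      window q (suc M) (+ 0) (n * q ^ suc (M ∸ suc k)) ∎)
    negative : sumℤ g M ≡ sumℤ (λ i → Fn (n * q ^ suc i)) M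
    negative = trans (sum-cong M g-negative) (sym (sum-reverse (λ i → Fn (n * q ^ suc i)) M))
    nonnegative : sumℤ (λ k → g (M + k)) (suc n) ≡ digitSum Fn n
    nonnegative = sum-cong (suc n) λ k _ → cong F (window-quot (suc M) M k n)

  b≡digitSum : ∀ M F → (∀ n → sumℤ (λ i → Fℕ q (suc M) F (n * q ^ suc i)) M ≡ + 0) →
               ∀ n → b q (suc M) F n ≡ digitSum (Fℕ q (suc M) F) n
  b≡digitSum M F vanish n = begin
    b q (suc M) F n                                       ≡⟨ b-decomposition M F n ⟩
    sumℤ (λ i → Fn (n * q ^ suc i)) M +ℤ digitSum Fn n    ≡⟨ cong (_+ℤ digitSum Fn n) (vanish n) ⟩
    + 0 +ℤ digitSum Fn n                                  ≡⟨ ℤ.+-identityˡ (digitSum Fn n) ⟩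
    digitSum Fn n                                         ∎
    where Fn = Fℕ q (suc M) F

  quot-< : 2 ≤ q → ∀ {j k} → j < k → digitQuot q (suc j) k < k
  quot-< q≥2 {j} {suc k} _ =
    m/n<m (suc k) (q ^ suc j) {{_}} {{m^n≢0 q (suc j)}} (^-monoʳ-< q q≥2 {0} {suc j} (s≤s z≤n))

  periodic-∣⇒digitSum-∣ : ∀ d G N .{{_ : NonZero N}} → (∀ x → G x ≡ G (x % N)) →
                          (∀ k → k < N → d ∣ G k) → ∀ n → d ∣ digitSum G n
  periodic-∣⇒digitSum-∣ d G N periodic d∣G n = sum-∣ d _ (suc n) λ j _ →
    subst (d ∣_) (sym (periodic _)) (d∣G _ (m%n<n _ N))

  -- If d divides the digit sums on [0, N), it divides G there: by strong
  -- induction, G(k) = digitSum G k − Σ_{j≥1} G(⌊k/q^j⌋) with smaller arguments.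
  digitSum-∣⇒∣ : 2 ≤ q → ∀ d G N → (∀ k → k < N → d ∣ digitSum G k) → ∀ k → k < N → d ∣ G k
  digitSum-∣⇒∣ q≥2 d G N d∣sum = <-rec (λ k → k < N → d ∣ G k) step
    where
    step : ∀ k → (∀ {j} → j < k → j < N → d ∣ G j) → k < N → d ∣ G k
    step k ih k<N = ∣-cancelʳ d (G k) rest
      (subst (d ∣_) (digitSum-uncons G k) (d∣sum k k<N))
      (sum-∣ d _ k λ j j<k → ih (quot-< q≥2 j<k) (<-trans (quot-< q≥2 j<k) k<N))
      where rest = sumℤ (λ j → G (digitQuot q (suc j) k)) k

lemma4 : (q : ℕ) → .{{_ : NonZero q}} → 2 ≤ q → (m : ℕ) → 1 ≤ m →
    (F : Vec (Fin q) m → ℤ) →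
    F (replicate m (zeroDigit q)) ≡ + 0 →
    (∀ (n : ℕ) → sumℤ (λ i → Fℕ q m F (n * q ^ suc i)) (m ∸ 1) ≡ + 0) →
    (m′ : ℕ) → 1 < m′ →
    ((∃[ n ] ¬ (+ m′ ∣ b q m F n)) ⇔ (∃[ n ] (n < q ^ m × ¬ (+ m′ ∣ Fℕ q m F n))))
    × ((∃[ n ] (n < q ^ m × ¬ (+ m′ ∣ Fℕ q m F n))) ⇔ (∃[ n ] (n < q ^ m × ¬ (+ m′ ∣ b q m F n))))
lemma4 q q≥2 (suc M) _ F _ vanish m′ _ =
  mk⇔ i⇒ii (iii⇒i ∘ ii⇒iii) , mk⇔ ii⇒iii (i⇒ii ∘ iii⇒i)
  where
  N = q ^ suc M
  instance _ = m^n≢0 q (suc M)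
  d = + m′
  Fn = Fℕ q (suc M) F
  bn = b q (suc M) F

  d∣? : ∀ x → Dec (d ∣ x)
  d∣? x = m′ ℕ.∣? ℤ.∣ x ∣

  F⇒b : (∀ k → k < N → d ∣ Fn k) → ∀ n → d ∣ bn n
  F⇒b d∣F n = subst (d ∣_) (sym (b≡digitSum q M F vanish n))
    (periodic-∣⇒digitSum-∣ q d Fn N (Fℕ-periodic q (suc M) F) d∣F n)

  b⇒F : (∀ k → k < N → d ∣ bn k) → ∀ k → k < N → d ∣ Fn k
  b⇒F d∣b = digitSum-∣⇒∣ q q≥2 d Fn N λ k k<N →
    subst (d ∣_) (b≡digitSum q M F vanish k) (d∣b k k<N)

  i⇒ii : (∃[ n ] ¬ (d ∣ bn n)) → ∃[ n ] (n < N × ¬ (d ∣ Fn n))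
  i⇒ii (n , d∤bn) = counterexample (d∣? ∘ Fn) N λ d∣F → d∤bn (F⇒b d∣F n)

  ii⇒iii : (∃[ n ] (n < N × ¬ (d ∣ Fn n))) → ∃[ n ] (n < N × ¬ (d ∣ bn n))
  ii⇒iii (n , n<N , d∤Fn) = counterexample (d∣? ∘ bn) N λ d∣b → d∤Fn (b⇒F d∣b n n<N)

  iii⇒i : (∃[ n ] (n < N × ¬ (d ∣ bn n))) → ∃[ n ] ¬ (d ∣ bn n)
  iii⇒i (n , _ , d∤bn) = n , d∤bn
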